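{- Let $d\ge 2$ and let $\varphi$ be a homomorphism from a graph $G$ to $F_d$. Then either $\varphi$ is surjective, or there exists a homomorphism from $G$ to $F_{d-1}$.
   Context: For an integer $d\ge1$, $F_d$ is the graph with vertex set $\{v_1,\dots,v_{3d-1}\}$ in which $v_j$ is adjacent to $v_{j+d},v_{j+d+1},\dots,v_{j+2d-1}$, indices taken modulo $3d-1$. A homomorphism from $G$ to $H$ is a map $V(G)\to V(H)$ sending adjacent vertices to adjacent vertices. -}

module Defs where

open import Data.Nat using (ℕ; suc; _+_; _*_; _∸_; _≤_; _%_)
open import Data.Fin using (Fin; toℕ)
open import Data.Product using (Σ; _×_)
open import Relation.Nullary using (¬_)

record Graph : Set₁ where
  field
    size   : ℕ
    Adj    : Fin size → Fin size → Set
    sym    : ∀ {x y} → Adj x y → Adj y x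
    irrefl : ∀ {x} → ¬ Adj x x

open Graph public

Vert : Graph → Set
Vert G = Fin (size G)

-- The graph F_d for d = suc k ≥ 1 has 3d - 1 = 3k + 2 vertices.
-- Vertex v_{j+1} of the paper is represented by j : Fin (3k+2).
FN : ℕ → ℕ
FN k = suc (suc (3 * k))

-- Adjacency in F_d (d = suc k): v_i ~ v_j iff (j - i) mod (3d-1) ∈ {d, ..., 2d-1}.
-- (This relation is symmetric and irreflexive.)  The difference is computed
-- as (j + (3d-1) - i) mod (3d-1) to stay in ℕ.
FAdj : (k : ℕ) → Fin (FN k) → Fin (FN k) → Set
FAdj k i j = suc k ≤ r × r ≤ 2 * suc k ∸ 1
  where
    r : ℕ
    r = (toℕ j + FN k ∸ toℕ i) % FN k

IsHomF : (G : Graph) (k : ℕ) → (Vert G → Fin (FN k)) → Set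
IsHomF G k f = ∀ {x y} → Adj G x y → FAdj k (f x) (f y)

HomF : Graph → ℕ → Set
HomF G k = Σ (Vert G → Fin (FN k)) (IsHomF G k)

-- F_d is the circulant graph on ℤ/(3d − 1) with connection set the window {d, …, 2d − 1}, so
-- translations are automorphisms, and since the window is symmetric, two residues p, q are
-- adjacent iff d ≤ |p − q| ≤ 2d − 1 in ℕ. If φ misses a vertex, translate it to the last vertex
-- 3d − 2; the image then lies in {0, …, 3d − 3}. Identifying d − 2 with d − 1 and 2d − 2 with
-- 2d − 1 shrinks every difference in {d, …, 2d − 1} by one or two, into the window
-- {d − 1, …, 2d − 3} of F_{d−1}, on the 3d − 4 remaining vertices.
module Submission where

open import Data.Fin as Fin using (Fin; toℕ; fromℕ<)
open import Data.Fin.Properties using (toℕ<n; toℕ-fromℕ<; toℕ-injective; any?; all?; ¬∀⟶∃¬)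
open import Data.List using ([]; _∷_)
open import Data.Nat
open import Data.Nat.DivMod
open import Data.Nat.Properties
open import Data.Nat.Tactic.RingSolver using (solve)
open import Algebra.Properties.CommutativeSemigroup +-commutativeSemigroup using (xy∙z≈xz∙y)
open import Data.Product using (∃; ∃₂; _×_; _,_)
open import Data.Sum using (_⊎_; inj₁; inj₂; [_,_]′) renaming (map to ⊎-map)
open import Function using (_∘_; id)
open import Relation.Nullary using (Dec; yes; no; contradiction)
open import Relation.Binary.PropositionalEquality

open import Defs hiding (sym)

[m%n+o]%n≡[m+o]%n : ∀ m o n .{{_ : NonZero n}} → (m % n + o) % n ≡ (m + o) % n
[m%n+o]%n≡[m+o]%n m o n = begin
  (m % n + o) % n         ≡⟨ %-distribˡ-+ (m % n) o n ⟩
  (m % n % n + o % n) % n ≡⟨ cong (λ x → (x + o % n) % n) (m%n%n≡m%n m n) ⟩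
  (m % n + o % n) % n     ≡⟨ %-distribˡ-+ m o n ⟨
  (m + o) % n             ∎
  where open ≡-Reasoning

+-%-cases : ∀ {a b n} .{{_ : NonZero n}} → a < n → b < n →
            a + b ≡ (a + b) % n ⊎ a + b ≡ (a + b) % n + n
+-%-cases {a} {b} {n} a<n b<n with a + b <? n
... | yes a+b<n = inj₁ (sym (m<n⇒m%n≡m a+b<n))
... | no  a+b≮n = inj₂ (begin
  a + b           ≡⟨ m∸n+n≡m n≤a+b ⟨
  x + n           ≡⟨ cong (_+ n) (m<n⇒m%n≡m x<n) ⟨
  x % n + n       ≡⟨ cong (_+ n) ([m+n]%n≡m%n x n) ⟨
  (x + n) % n + n ≡⟨ cong (λ y → y % n + n) (m∸n+n≡m n≤a+b) ⟩
  (a + b) % n + n ∎)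
  where
  open ≡-Reasoning
  n≤a+b : n ≤ a + b
  n≤a+b = ≮⇒≥ a+b≮n
  x : ℕ
  x = a + b ∸ n
  x<n : x < n
  x<n = +-cancelʳ-< n x n (subst (_< n + n) (sym (m∸n+n≡m n≤a+b)) (+-mono-< a<n b<n))

[[i+r]%n+n∸i]%n≡r : ∀ {i r n} .{{_ : NonZero n}} → i < n → r < n →
                    ((i + r) % n + n ∸ i) % n ≡ r
[[i+r]%n+n∸i]%n≡r {i} {r} {n} i<n r<n with +-%-cases i<n r<n
... | inj₁ no-wrap = begin
  ((i + r) % n + n ∸ i) % n ≡⟨ cong (λ y → (y + n ∸ i) % n) no-wrap ⟨
  (i + r + n ∸ i) % n       ≡⟨ cong (λ y → (y ∸ i) % n) (+-assoc i r n) ⟩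
  (i + (r + n) ∸ i) % n     ≡⟨ cong (_% n) (m+n∸m≡n i (r + n)) ⟩
  (r + n) % n               ≡⟨ [m+n]%n≡m%n r n ⟩
  r % n                     ≡⟨ m<n⇒m%n≡m r<n ⟩
  r                         ∎
  where open ≡-Reasoning
... | inj₂ wrap = begin
  ((i + r) % n + n ∸ i) % n ≡⟨ cong (λ y → (y ∸ i) % n) wrap ⟨
  (i + r ∸ i) % n           ≡⟨ cong (_% n) (m+n∸m≡n i r) ⟩
  r % n                     ≡⟨ m<n⇒m%n≡m r<n ⟩
  r                         ∎
  where open ≡-Reasoning

[i+[j+n∸i]%n]%n≡j : ∀ {i j n} .{{_ : NonZero n}} → i ≤ n → j < n →
                    (i + (j + n ∸ i) % n) % n ≡ j
[i+[j+n∸i]%n]%n≡j {i} {j} {n} i≤n j<n = begin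
  (i + (j + n ∸ i) % n) % n ≡⟨ cong (_% n) (+-comm i _) ⟩
  ((j + n ∸ i) % n + i) % n ≡⟨ [m%n+o]%n≡[m+o]%n (j + n ∸ i) i n ⟩
  (j + n ∸ i + i) % n       ≡⟨ cong (_% n) (m∸n+n≡m (≤-trans i≤n (m≤n+m n j))) ⟩
  (j + n) % n               ≡⟨ [m+n]%n≡m%n j n ⟩
  j % n                     ≡⟨ m<n⇒m%n≡m j<n ⟩
  j                         ∎
  where open ≡-Reasoning

-- For d = suc m, the numbers suc m + s with s + s' ≡ m form the window {d, …, 2d − 1}.
Ahead : ℕ → ℕ → ℕ → Set
Ahead m p q = ∃₂ λ s s' → s + s' ≡ m × p + (suc m + s) ≡ q

Linked : ℕ → ℕ → ℕ → Set
Linked m p q = Ahead m p q ⊎ Ahead m q p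

Step : ℕ → ℕ → ℕ → Set
Step m p q = ∃₂ λ s s' → s + s' ≡ m × (p + (suc m + s)) % FN m ≡ q

FN≡[1+m+s]+[1+m+s'] : ∀ {m s s'} → s + s' ≡ m → FN m ≡ (suc m + s) + (suc m + s')
FN≡[1+m+s]+[1+m+s'] {s = s} {s'} refl = begin
  suc (suc (3 * (s + s')))                 ≡⟨ solve (s ∷ s' ∷ []) ⟩
  (suc (s + s') + s) + (suc (s + s') + s') ∎
  where open ≡-Reasoning

1+m+s<FN : ∀ {m s s'} → s + s' ≡ m → suc m + s < FN m
1+m+s<FN {m} {s} e = subst (suc m + s <_) (sym (FN≡[1+m+s]+[1+m+s'] e)) (m<m+n (suc m + s) z<s)

2*[1+m]∸1≡1+m+m : ∀ m → 2 * suc m ∸ 1 ≡ suc m + m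
2*[1+m]∸1≡1+m+m m = trans (cong (m +_) (+-identityʳ (suc m))) (+-suc m m)

window⇒offset : ∀ {m r} → suc m ≤ r → r ≤ 2 * suc m ∸ 1 →
                ∃₂ λ s s' → s + s' ≡ m × suc m + s ≡ r
window⇒offset {m} lo hi with m≤n⇒∃[o]m+o≡n lo
... | s , refl
  with m≤n⇒∃[o]m+o≡n (+-cancelˡ-≤ (suc m) s m (subst (suc m + s ≤_) (2*[1+m]∸1≡1+m+m m) hi))
...   | s' , e = s , s' , e , refl

offset⇒window : ∀ {m s s'} → s + s' ≡ m → suc m ≤ suc m + s × suc m + s ≤ 2 * suc m ∸ 1
offset⇒window {m} {s} {s'} e =
  m≤m+n (suc m) s ,
  subst (suc m + s ≤_) (sym (2*[1+m]∸1≡1+m+m m))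
        (+-monoʳ-≤ (suc m) (subst (s ≤_) e (m≤m+n s s')))

FAdj⇒Step : ∀ {m} {i j : Fin (FN m)} → FAdj m i j → Step m (toℕ i) (toℕ j)
FAdj⇒Step {m} {i} {j} (lo , hi) with window⇒offset lo hi
... | s , s' , e , r≡ = s , s' , e , (begin
  (toℕ i + (suc m + s)) % FN m                   ≡⟨ cong (λ r → (toℕ i + r) % FN m) r≡ ⟩
  (toℕ i + (toℕ j + FN m ∸ toℕ i) % FN m) % FN m
    ≡⟨ [i+[j+n∸i]%n]%n≡j (<⇒≤ (toℕ<n i)) (toℕ<n j) ⟩
  toℕ j                                          ∎)
  where open ≡-Reasoning

Step⇒FAdj : ∀ {m} {i j : Fin (FN m)} → Step m (toℕ i) (toℕ j) → FAdj m i j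
Step⇒FAdj {m} {i} {j} (s , s' , e , ij) =
  subst (λ r → suc m ≤ r × r ≤ 2 * suc m ∸ 1) (sym r≡) (offset⇒window e)
  where
  r≡ : (toℕ j + FN m ∸ toℕ i) % FN m ≡ suc m + s
  r≡ = subst (λ j → (j + FN m ∸ toℕ i) % FN m ≡ suc m + s) ij
         ([[i+r]%n+n∸i]%n≡r (toℕ<n i) (1+m+s<FN e))

Step-translate : ∀ {m p q} c → Step m p q → Step m ((p + c) % FN m) ((q + c) % FN m)
Step-translate {m} {p} {q} c (s , s' , e , pq) = s , s' , e , (begin
  ((p + c) % N + r) % N ≡⟨ [m%n+o]%n≡[m+o]%n (p + c) r N ⟩
  (p + c + r) % N       ≡⟨ cong (_% N) (xy∙z≈xz∙y p c r) ⟩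
  (p + r + c) % N       ≡⟨ [m%n+o]%n≡[m+o]%n (p + r) c N ⟨
  ((p + r) % N + c) % N ≡⟨ cong (λ x → (x + c) % N) pq ⟩
  (q + c) % N           ∎)
  where
  open ≡-Reasoning
  N r : ℕ
  N = FN m
  r = suc m + s

Step⇒Linked : ∀ {m p q} → p < FN m → Step m p q → Linked m p q
Step⇒Linked {m} {p} {q} p<N (s , s' , e , pq) with +-%-cases p<N (1+m+s<FN e)
... | inj₁ no-wrap = inj₁ (s , s' , e , trans no-wrap pq)
... | inj₂ wrap    = inj₂ (s' , s , trans (+-comm s' s) e , +-cancelʳ-≡ (suc m + s) _ _ (begin
  q + (suc m + s') + (suc m + s)   ≡⟨ solve (q ∷ m ∷ s ∷ s' ∷ []) ⟩
  q + ((suc m + s) + (suc m + s')) ≡⟨ cong (q +_) (FN≡[1+m+s]+[1+m+s'] e) ⟨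
  q + FN m                         ≡⟨ cong (_+ FN m) pq ⟨
  (p + (suc m + s)) % FN m + FN m  ≡⟨ wrap ⟨
  p + (suc m + s)                  ∎))
  where open ≡-Reasoning

Linked⇒Step : ∀ {m p q} → q < FN m → Linked m p q → Step m p q
Linked⇒Step {m} q<N (inj₁ (s , s' , e , pq)) =
  s , s' , e , trans (cong (_% FN m) pq) (m<n⇒m%n≡m q<N)
Linked⇒Step {m} {p} {q} q<N (inj₂ (s , s' , e , qp)) = s' , s , trans (+-comm s' s) e , (begin
  (p + (suc m + s')) % FN m                 ≡⟨ cong (λ x → (x + (suc m + s')) % FN m) qp ⟨
  (q + (suc m + s) + (suc m + s')) % FN m   ≡⟨ cong (_% FN m) (+-assoc q _ _) ⟩
  (q + ((suc m + s) + (suc m + s'))) % FN m ≡⟨ cong (λ x → (q + x) % FN m) (FN≡[1+m+s]+[1+m+s'] e) ⟨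
  (q + FN m) % FN m                         ≡⟨ [m+n]%n≡m%n q (FN m) ⟩
  q % FN m                                  ≡⟨ m<n⇒m%n≡m q<N ⟩
  q                                         ∎)
  where open ≡-Reasoning

rotate : ℕ → ℕ → ℕ → ℕ
rotate m v x = (x + (FN m ∸ suc v)) % FN m

rotate≡last⇒≡ : ∀ {m v x} → v < FN m → x < FN m → rotate m v x ≡ suc (3 * m) → x ≡ v
rotate≡last⇒≡ {m} {v} {x} v<N x<N eq = [ no-wrap , wrap ]′ (+-%-cases x<N c<N)
  where
  open ≡-Reasoning
  c : ℕ
  c = FN m ∸ suc v
  c<N : c < FN m
  c<N = ∸-monoʳ-< z<s v<N
  no-wrap : x + c ≡ (x + c) % FN m → x ≡ v
  no-wrap x+c≡ = +-cancelʳ-≡ c x v (begin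
    x + c       ≡⟨ trans x+c≡ eq ⟩
    suc (3 * m) ≡⟨ suc-injective (m+[n∸m]≡n v<N) ⟨
    v + c       ∎)
  wrap : x + c ≡ (x + c) % FN m + FN m → x ≡ v
  wrap x+c≡ = contradiction
    (subst (_≤ suc (3 * m) + suc (3 * m)) (trans x+c≡ (cong (_+ FN m) eq))
           (+-mono-≤ (s≤s⁻¹ x<N) (s≤s⁻¹ c<N)))
    (<⇒≱ (+-monoʳ-< (suc (3 * m)) ≤-refl))

rotate≤3m : ∀ {m v x} → v < FN m → x < FN m → x ≢ v → rotate m v x ≤ 3 * m
rotate≤3m {m} {v} {x} v<N x<N x≢v =
  s≤s⁻¹ (≤∧≢⇒< (s≤s⁻¹ (m%n<n (x + (FN m ∸ suc v)) (FN m)))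
                (x≢v ∘ rotate≡last⇒≡ {m} v<N x<N))

data Region (k : ℕ) : ℕ → Set where
  low  : ∀ {p} → p ≤ k → Region k p
  mid  : ∀ {y} → y ≤ suc k → Region k (suc k + y)
  high : ∀ z → Region k (suc k + (suc (suc k) + z))

region : ∀ k p → Region k p
region k p with p ≤? k
... | yes p≤k = low p≤k
... | no  p≰k with m≤n⇒∃[o]m+o≡n (≰⇒> p≰k)
...   | y , refl with y ≤? suc k
...     | yes y≤1+k = mid y≤1+k
...     | no  y≰1+k with m≤n⇒∃[o]m+o≡n (≰⇒> y≰1+k)
...       | z , refl = high z

-- Identifies k with suc k and 2k + 2 with 2k + 3, i.e. d − 2 with d − 1 and 2d − 2 with 2d − 1.
collapse : ℕ → ℕ → ℕ
collapse k p with region k p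
... | low _     = p
... | mid {y} _ = k + y
... | high z    = k + (suc k + z)

collapse<FN : ∀ {k p} → p ≤ 3 * suc k → collapse k p < FN k
collapse<FN {k} {p} p≤ with region k p
... | low p≤k       = s≤s (m≤n⇒m≤1+n (≤-trans p≤k (m≤m+n k _)))
... | mid {y} y≤1+k =
  s≤s (subst (k + y ≤_) (+-suc k (2 * k)) (+-monoʳ-≤ k (≤-trans y≤1+k (s≤s (m≤m+n k _)))))
... | high z        =
  s≤s⁻¹ (subst₂ _≤_ (cong suc (+-suc k (suc k + z))) (*-distribˡ-+ 3 1 k) p≤)

Ahead⇒≤ : ∀ {m p q} → Ahead m p q → p + suc m ≤ q
Ahead⇒≤ {m} {p} (s , _ , _ , pq) = subst (p + suc m ≤_) pq (+-monoʳ-≤ p (m≤m+n (suc m) s))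

Ahead-low-mid : ∀ {k p y} → y ≤ suc k → Ahead (suc k) p (suc k + y) → Ahead k p (k + y)
Ahead-low-mid {k} {p} {y} y≤1+k (s , zero , e , pq) =
  contradiction (+-monoʳ-≤ (suc k) y≤1+k) (<⇒≱ 2[1+k]<q)
  where
  open ≤-Reasoning
  s≡1+k : s ≡ suc k
  s≡1+k = trans (sym (+-identityʳ s)) e
  2[1+k]<q : suc k + suc k < suc k + y
  2[1+k]<q = begin-strict
    suc k + suc k         <⟨ n<1+n _ ⟩
    suc (suc k) + suc k   ≡⟨ cong (suc (suc k) +_) s≡1+k ⟨
    suc (suc k) + s       ≤⟨ m≤n+m _ p ⟩
    p + (suc (suc k) + s) ≡⟨ pq ⟩
    suc k + y             ∎
Ahead-low-mid {k} {p} _ (s , suc t' , e , pq) =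
  s , t' , suc-injective (trans (sym (+-suc s t')) e) ,
  suc-injective (trans (sym (+-suc p (suc k + s))) pq)

Ahead-low-high : ∀ {k p z} → p ≤ k →
                 Ahead (suc k) p (suc k + (suc (suc k) + z)) → Ahead k p (k + (suc k + z))
Ahead-low-high {k} {p} {z} p≤k (zero , s' , e , pq) =
  contradiction p≤k (<⇒≱ (subst (k <_) (sym p≡1+k+z) (m≤m+n (suc k) z)))
  where
  open ≡-Reasoning
  p≡1+k+z : p ≡ suc k + z
  p≡1+k+z = +-cancelʳ-≡ (suc (suc k)) p (suc k + z) (begin
    p + suc (suc k)           ≡⟨ cong (p +_) (+-identityʳ _) ⟨
    p + (suc (suc k) + 0)     ≡⟨ pq ⟩
    suc k + (suc (suc k) + z) ≡⟨ solve (k ∷ z ∷ []) ⟩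
    suc k + z + suc (suc k)   ∎)
Ahead-low-high {k} {p} {z} _ (suc t , s' , e , pq) =
  t , s' , suc-injective e , +-cancelˡ-≡ 2 _ _ (begin
  2 + (p + (suc k + t))     ≡⟨ solve (p ∷ k ∷ t ∷ []) ⟩
  p + (suc (suc k) + suc t) ≡⟨ pq ⟩
  suc k + (suc (suc k) + z) ≡⟨ solve (k ∷ z ∷ []) ⟩
  2 + (k + (suc k + z))     ∎)
  where open ≡-Reasoning

Ahead-mid-high : ∀ {k y z} → suc k + (suc (suc k) + z) ≤ 3 * suc k →
                 Ahead (suc k) (suc k + y) (suc k + (suc (suc k) + z)) →
                 Ahead k (k + y) (k + (suc k + z))
Ahead-mid-high {k} {y} {z} q≤ (s , zero , e , pq) = contradiction q≤ (<⇒≱ 3[1+k]<q)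
  where
  open ≤-Reasoning
  s≡1+k : s ≡ suc k
  s≡1+k = trans (sym (+-identityʳ s)) e
  3[1+k]<q : 3 * suc k < suc k + (suc (suc k) + z)
  3[1+k]<q = begin-strict
    3 * suc k                     <⟨ n<1+n _ ⟩
    suc (3 * suc k)               ≡⟨ solve (k ∷ []) ⟩
    suc k + (suc (suc k) + suc k) ≡⟨ cong (λ x → suc k + (suc (suc k) + x)) s≡1+k ⟨
    suc k + (suc (suc k) + s)     ≤⟨ +-monoˡ-≤ _ (m≤m+n (suc k) y) ⟩
    suc k + y + (suc (suc k) + s) ≡⟨ pq ⟩
    suc k + (suc (suc k) + z)     ∎
Ahead-mid-high {k} {y} {z} _ (s , suc t' , e , pq) =
  s , t' , suc-injective (trans (sym (+-suc s t')) e) , +-cancelˡ-≡ (suc (suc k)) _ _ (begin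
    suc (suc k) + (k + y + (suc k + s)) ≡⟨ solve (k ∷ y ∷ s ∷ []) ⟩
    k + (suc k + y + (suc (suc k) + s)) ≡⟨ cong (k +_) pq ⟩
    k + (suc k + (suc (suc k) + z))     ≡⟨ solve (k ∷ z ∷ []) ⟩
    suc (suc k) + (k + (suc k + z))     ∎)
  where open ≡-Reasoning

Ahead-collapse : ∀ {k p q} → q ≤ 3 * suc k →
                 Ahead (suc k) p q → Ahead k (collapse k p) (collapse k q)
Ahead-collapse {k} {p} {q} q≤ ahead with region k p | region k q
... | low _     | mid y≤1+k = Ahead-low-mid y≤1+k ahead
... | low p≤k   | high _    = Ahead-low-high p≤k ahead
... | mid _     | high _    = Ahead-mid-high q≤ ahead
... | _         | low q≤k   = contradiction q≤k (<⇒≱ k<q)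
  where
  open ≤-Reasoning
  k<q : k < q
  k<q = begin-strict
    k               <⟨ n<1+n k ⟩
    suc k           ≤⟨ n≤1+n (suc k) ⟩
    suc (suc k)     ≤⟨ m≤n+m _ p ⟩
    p + suc (suc k) ≤⟨ Ahead⇒≤ ahead ⟩
    q               ∎
... | mid {yp} _ | mid yq≤1+k = contradiction (+-monoʳ-≤ (suc k) yq≤1+k) (<⇒≱ 2[1+k]<q)
  where
  open ≤-Reasoning
  2[1+k]<q : suc k + suc k < q
  2[1+k]<q = begin-strict
    suc k + suc k            <⟨ +-monoʳ-< (suc k) (n<1+n (suc k)) ⟩
    suc k + suc (suc k)      ≤⟨ +-monoˡ-≤ (suc (suc k)) (m≤m+n (suc k) yp) ⟩
    suc k + yp + suc (suc k) ≤⟨ Ahead⇒≤ {p = suc k + yp} ahead ⟩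
    q                        ∎
... | high zp | _ = contradiction q≤ (<⇒≱ 3[1+k]<q)
  where
  open ≤-Reasoning
  3[1+k]<q : 3 * suc k < q
  3[1+k]<q = begin-strict
    3 * suc k                                <⟨ m<m+n (3 * suc k) {suc (suc zp)} z<s ⟩
    3 * suc k + suc (suc zp)                 ≡⟨ solve (k ∷ zp ∷ []) ⟩
    suc k + (suc (suc k) + zp) + suc (suc k) ≤⟨ Ahead⇒≤ {p = suc k + (suc (suc k) + zp)} ahead ⟩
    q                                        ∎

Linked-collapse : ∀ {k p q} → p ≤ 3 * suc k → q ≤ 3 * suc k →
                  Linked (suc k) p q → Linked k (collapse k p) (collapse k q)
Linked-collapse p≤ q≤ = ⊎-map (Ahead-collapse q≤) (Ahead-collapse p≤)

module _ {k : ℕ} (v : Fin (FN (suc k))) where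

  shift : Fin (FN (suc k)) → ℕ
  shift u = rotate (suc k) (toℕ v) (toℕ u)

  shift≤ : ∀ {u} → u ≢ v → shift u ≤ 3 * suc k
  shift≤ {u} u≢v = rotate≤3m {suc k} (toℕ<n v) (toℕ<n u) (u≢v ∘ toℕ-injective)

  squeeze : (u : Fin (FN (suc k))) → u ≢ v → Fin (FN k)
  squeeze u u≢v = fromℕ< (collapse<FN (shift≤ u≢v))

  toℕ-squeeze : ∀ {u} (u≢v : u ≢ v) → toℕ (squeeze u u≢v) ≡ collapse k (shift u)
  toℕ-squeeze u≢v = toℕ-fromℕ< (collapse<FN (shift≤ u≢v))

  squeeze-FAdj : ∀ {u w} (u≢v : u ≢ v) (w≢v : w ≢ v) →
                 FAdj (suc k) u w → FAdj k (squeeze u u≢v) (squeeze w w≢v)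
  squeeze-FAdj {u} {w} u≢v w≢v adj =
    Step⇒FAdj {k} {squeeze u u≢v} {squeeze w w≢v}
      (subst₂ (Step k) (sym (toℕ-squeeze u≢v)) (sym (toℕ-squeeze w≢v)) collapsed)
    where
    shifted : Step (suc k) (shift u) (shift w)
    shifted = Step-translate {suc k} {toℕ u} {toℕ w} (FN (suc k) ∸ suc (toℕ v))
                (FAdj⇒Step {suc k} {u} {w} adj)
    shift<FN : shift u < FN (suc k)
    shift<FN = m%n<n (toℕ u + (FN (suc k) ∸ suc (toℕ v))) (FN (suc k))
    collapsed : Step k (collapse k (shift u)) (collapse k (shift w))
    collapsed = Linked⇒Step {k} (collapse<FN (shift≤ w≢v))
      (Linked-collapse (shift≤ u≢v) (shift≤ w≢v)
        (Step⇒Linked {suc k} {shift u} {shift w} shift<FN shifted))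

avoiding⇒HomF : ∀ {k} G (φ : Vert G → Fin (FN (suc k))) → IsHomF G (suc k) φ →
                ∀ v → (∀ x → φ x ≢ v) → HomF G k
avoiding⇒HomF G φ hom v avoids =
  (λ x → squeeze v (φ x) (avoids x)) , λ adj → squeeze-FAdj v (avoids _) (avoids _) (hom adj)

hit? : ∀ {m n} (f : Fin m → Fin n) v → Dec (∃ λ x → f x ≡ v)
hit? f v = any? λ x → f x Fin.≟ v

onto⊎missed : ∀ {m n} (f : Fin m → Fin n) →
              (∀ v → ∃ λ x → f x ≡ v) ⊎ ∃ λ v → ∀ x → f x ≢ v
onto⊎missed f with all? (hit? f)
... | yes onto = inj₁ onto
... | no ¬onto with ¬∀⟶∃¬ _ _ (hit? f) ¬onto
...   | v , missed = inj₂ (v , λ x fx≡v → missed (x , fx≡v))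

lemma2p6 : (k : ℕ) (G : Graph) (φ : Vert G → Fin (FN (suc k))) → IsHomF G (suc k) φ →
    (∀ (v : Fin (FN (suc k))) → ∃ λ x → φ x ≡ v) ⊎ HomF G k
lemma2p6 k G φ hom =
  ⊎-map id (λ (v , missed) → avoiding⇒HomF G φ hom v missed) (onto⊎missed φ)
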